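{- Let $L$ be an intermediate logic. If (structural) Skolemization is sound and complete for $L$, i.e. for every formula $\varphi$, $L\vdash\varphi$ iff $L\vdash\varphi^S$, then $\mathsf{QFS}\subseteq L$.
   Context: Logics are sets of first-order formulas containing $\mathsf{IQC}$ and closed under its axioms and rules; intermediate means $\mathsf{IQC}\subseteq L\subseteq\mathsf{CQC}$. $\mathsf{QFS}=\mathsf{IQC}+\{\mathrm{CD},\mathrm{ED},\mathrm{SW}\}$ where, for all $A(x),B$ with $x$ not free in $B$: $\mathrm{CD}$: $\forall x(A(x)\vee B)\to\forall xA(x)\vee B$; $\mathrm{ED}$: $(B\to\exists xA(x))\to\exists x(B\to A(x))$; $\mathrm{SW}$: $(\forall xA(x)\to B)\to\exists x(A(x)\to B)$. A quantifier occurrence is positive if it is in the antecedent of an even number of implications ($\neg A:=A\to\bot$), negative otherwise; strong if positive $\forall$ or negative $\exists$, weak otherwise. Structural Skolemization $\varphi^S$ of a closed formula: repeatedly take the first strong quantifier $(Qy)$, delete it and replace $y$ by $f(x_1,\dots,x_n)$ where $(Q_1x_1)\dots(Q_nx_n)$ are the weak quantifiers in whose scope it lies and $f$ is a fresh function symbol (a fresh constant if $n=0$), until no strong quantifiers remain. -}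

module Defs where

open import Data.Nat using (ℕ; zero; suc; _+_; _⊔_)
open import Data.Bool using (Bool; true; false; not; _∧_; if_then_else_; T)
open import Data.Vec using (Vec; []; _∷_)
open import Data.List using (List; []; _∷_)
open import Data.Product using (_×_; _,_)
open import Data.Empty using (⊥)
open import Data.Nat using (_<ᵇ_)

-- First-order language (without equality), de Bruijn variables.
-- Function symbols: fn k i  = the i-th function symbol of arity k
-- (arity 0 = constants). Predicate symbols: rel k i likewise.

data Term : Set where
  var : ℕ → Term
  fn  : (k i : ℕ) → Vec Term k → Term

infixr 6 _∧'_
infixr 5 _∨'_
infixr 4 _⇒_

data Formula : Set where
  rel  : (k i : ℕ) → Vec Term k → Formula
  ⊥'   : Formula
  _∧'_ : Formula → Formula → Formula
  _∨'_ : Formula → Formula → Formula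
  _⇒_  : Formula → Formula → Formula
  ∀'   : Formula → Formula
  ∃'   : Formula → Formula

¬' : Formula → Formula
¬' A = A ⇒ ⊥'

ext : (ℕ → ℕ) → ℕ → ℕ
ext ρ zero = zero
ext ρ (suc n) = suc (ρ n)

mutual
  renT : (ℕ → ℕ) → Term → Term
  renT ρ (var n) = var (ρ n)
  renT ρ (fn k i ts) = fn k i (renTs ρ ts)

  renTs : ∀ {k} → (ℕ → ℕ) → Vec Term k → Vec Term k
  renTs ρ [] = []
  renTs ρ (t ∷ ts) = renT ρ t ∷ renTs ρ ts

renF : (ℕ → ℕ) → Formula → Formula
renF ρ (rel k i ts) = rel k i (renTs ρ ts)
renF ρ ⊥' = ⊥'
renF ρ (A ∧' B) = renF ρ A ∧' renF ρ B
renF ρ (A ∨' B) = renF ρ A ∨' renF ρ B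
renF ρ (A ⇒ B) = renF ρ A ⇒ renF ρ B
renF ρ (∀' A) = ∀' (renF (ext ρ) A)
renF ρ (∃' A) = ∃' (renF (ext ρ) A)

-- shift every free variable up by one (used for "x not free in B")
shift : Formula → Formula
shift = renF suc

exts : (ℕ → Term) → ℕ → Term
exts σ zero = var zero
exts σ (suc n) = renT suc (σ n)

mutual
  subT : (ℕ → Term) → Term → Term
  subT σ (var n) = σ n
  subT σ (fn k i ts) = fn k i (subTs σ ts)

  subTs : ∀ {k} → (ℕ → Term) → Vec Term k → Vec Term k
  subTs σ [] = []
  subTs σ (t ∷ ts) = subT σ t ∷ subTs σ ts

subF : (ℕ → Term) → Formula → Formula
subF σ (rel k i ts) = rel k i (subTs σ ts)
subF σ ⊥' = ⊥'
subF σ (A ∧' B) = subF σ A ∧' subF σ B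
subF σ (A ∨' B) = subF σ A ∨' subF σ B
subF σ (A ⇒ B) = subF σ A ⇒ subF σ B
subF σ (∀' A) = ∀' (subF (exts σ) A)
subF σ (∃' A) = ∃' (subF (exts σ) A)

inst : Term → ℕ → Term
inst t zero = t
inst t (suc n) = var n

_[_/0] : Formula → Term → Formula
A [ t /0] = subF (inst t) A

data IQCAxiom : Formula → Set where
  k-ax   : ∀ A B → IQCAxiom (A ⇒ B ⇒ A)
  s-ax   : ∀ A B C → IQCAxiom ((A ⇒ B ⇒ C) ⇒ (A ⇒ B) ⇒ A ⇒ C)
  ∧e₁    : ∀ A B → IQCAxiom (A ∧' B ⇒ A)
  ∧e₂    : ∀ A B → IQCAxiom (A ∧' B ⇒ B)
  ∧i     : ∀ A B → IQCAxiom (A ⇒ B ⇒ A ∧' B)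
  ∨i₁    : ∀ A B → IQCAxiom (A ⇒ A ∨' B)
  ∨i₂    : ∀ A B → IQCAxiom (B ⇒ A ∨' B)
  ∨e     : ∀ A B C → IQCAxiom ((A ⇒ C) ⇒ (B ⇒ C) ⇒ A ∨' B ⇒ C)
  ⊥e     : ∀ A → IQCAxiom (⊥' ⇒ A)
  ∀e     : ∀ A t → IQCAxiom (∀' A ⇒ A [ t /0])
  ∃i     : ∀ A t → IQCAxiom (A [ t /0] ⇒ ∃' A)
  ∀i     : ∀ A B → IQCAxiom (∀' (shift B ⇒ A) ⇒ B ⇒ ∀' A)
  ∃e     : ∀ A B → IQCAxiom (∀' (A ⇒ shift B) ⇒ ∃' A ⇒ B)

data Derivable (Ax : Formula → Set) : Formula → Set where
  iqc : ∀ {A} → IQCAxiom A → Derivable Ax A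
  ax  : ∀ {A} → Ax A → Derivable Ax A
  mp  : ∀ {A B} → Derivable Ax (A ⇒ B) → Derivable Ax A → Derivable Ax B
  gen : ∀ {A} → Derivable Ax A → Derivable Ax (∀' A)

NoAx : Formula → Set
NoAx _ = ⊥

IQC : Formula → Set
IQC = Derivable NoAx

data LEM : Formula → Set where
  lem : ∀ A → LEM (A ∨' ¬' A)

CQC : Formula → Set
CQC = Derivable LEM

-- CD, ED, SW ("x not free in B" is expressed by shifting B)
data QFSAxiom : Formula → Set where
  CD : ∀ A B → QFSAxiom (∀' (A ∨' shift B) ⇒ ∀' A ∨' B)
  ED : ∀ A B → QFSAxiom ((B ⇒ ∃' A) ⇒ ∃' (shift B ⇒ A))
  SW : ∀ A B → QFSAxiom ((∀' A ⇒ B) ⇒ ∃' (A ⇒ shift B))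

QFS : Formula → Set
QFS = Derivable QFSAxiom

record IsLogic (L : Formula → Set) : Set where
  field
    axioms : ∀ {A} → IQCAxiom A → L A
    closed-mp  : ∀ {A B} → L (A ⇒ B) → L A → L B
    closed-gen : ∀ {A} → L A → L (∀' A)

record IsIntermediate (L : Formula → Set) : Set where
  field
    isLogic : IsLogic L
    iqc⊆ : ∀ A → IQC A → L A
    ⊆cqc : ∀ A → L A → CQC A

mutual
  closedT : ℕ → Term → Bool
  closedT d (var n) = n <ᵇ d
  closedT d (fn k i ts) = closedTs d ts

  closedTs : ∀ {k} → ℕ → Vec Term k → Bool
  closedTs d [] = true
  closedTs d (t ∷ ts) = closedT d t ∧ closedTs d ts

closedF : ℕ → Formula → Bool
closedF d (rel k i ts) = closedTs d ts
closedF d ⊥' = true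
closedF d (A ∧' B) = closedF d A ∧ closedF d B
closedF d (A ∨' B) = closedF d A ∧ closedF d B
closedF d (A ⇒ B) = closedF d A ∧ closedF d B
closedF d (∀' A) = closedF (suc d) A
closedF d (∃' A) = closedF (suc d) A

Closed : Formula → Set
Closed A = T (closedF zero A)

mutual
  maxFnT : Term → ℕ
  maxFnT (var n) = zero
  maxFnT (fn k i ts) = i ⊔ maxFnTs ts

  maxFnTs : ∀ {k} → Vec Term k → ℕ
  maxFnTs [] = zero
  maxFnTs (t ∷ ts) = maxFnT t ⊔ maxFnTs ts

maxFnF : Formula → ℕ
maxFnF (rel k i ts) = maxFnTs ts
maxFnF ⊥' = zero
maxFnF (A ∧' B) = maxFnF A ⊔ maxFnF B
maxFnF (A ∨' B) = maxFnF A ⊔ maxFnF B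
maxFnF (A ⇒ B) = maxFnF A ⊔ maxFnF B
maxFnF (∀' A) = maxFnF A
maxFnF (∃' A) = maxFnF A

-- variables of the d weak quantifiers in scope, outermost first
skArgs : (d : ℕ) → Vec Term d
skArgs zero = []
skArgs (suc d) = var d ∷ skArgs d

lookupEnv : List Term → ℕ → Term
lookupEnv [] n = var n
lookupEnv (t ∷ env) zero = t
lookupEnv (t ∷ env) (suc n) = lookupEnv env n

shiftEnv : List Term → List Term
shiftEnv [] = []
shiftEnv (t ∷ env) = renT suc t ∷ shiftEnv env

-- sk base pos d env c A:
--   pos  : whether the current position is positive
--   d    : number of (weak) quantifiers kept so far around this position
--   env  : for each bound variable of the input, its replacement
--          (a variable of the output or a Skolem term)
--   c    : counter of Skolem symbols used so far (processed left to right)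
-- The n-th Skolem symbol is the function symbol with index base + n and
-- arity = number of weak quantifiers in whose scope the strong one lies.
sk : ℕ → Bool → ℕ → List Term → ℕ → Formula → Formula × ℕ
sk b p d env c (rel k i ts) = rel k i (subTs (lookupEnv env) ts) , c
sk b p d env c ⊥' = ⊥' , c
sk b p d env c (A ∧' B) with sk b p d env c A
... | A' , c₁ with sk b p d env c₁ B
... | B' , c₂ = A' ∧' B' , c₂
sk b p d env c (A ∨' B) with sk b p d env c A
... | A' , c₁ with sk b p d env c₁ B
... | B' , c₂ = A' ∨' B' , c₂
sk b p d env c (A ⇒ B) with sk b (not p) d env c A
... | A' , c₁ with sk b p d env c₁ B
... | B' , c₂ = (A' ⇒ B') , c₂
sk b true d env c (∀' A) =            -- strong: delete
  sk b true d (fn d (b + c) (skArgs d) ∷ env) (suc c) A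
sk b false d env c (∀' A) with sk b false (suc d) (var zero ∷ shiftEnv env) c A
... | A' , c₁ = ∀' A' , c₁           -- weak: keep
sk b false d env c (∃' A) =           -- strong: delete
  sk b false d (fn d (b + c) (skArgs d) ∷ env) (suc c) A
sk b true d env c (∃' A) with sk b true (suc d) (var zero ∷ shiftEnv env) c A
... | A' , c₁ = ∃' A' , c₁           -- weak: keep

skolem : Formula → Formula
skolem A with sk (suc (maxFnF A)) true zero [] zero A
... | A' , _ = A'

module Submission where

-- Each QFS axiom says that a quantifier can be moved across a formula not
-- containing its variable, and Skolemization turns it into an instance of an
-- IQC quantifier axiom: the Skolemization of CD, for instance, is
-- ∀x(A(x) ∨ B) → A(c) ∨ B.  Inside A and B the remaining strong quantifiers
-- cause no harm, because Skolemizing a formula in positive position only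
-- weakens it and in negative position only strengthens it, provably in IQC.
-- Hence the Skolemization of the universal closure of every QFS axiom is
-- IQC-provable; completeness of Skolemization for L puts the closure, and so
-- the axiom itself, into L, and a logic containing the axioms of QFS contains
-- all of QFS.

open import Defs
open import Data.Bool using (Bool; true; false; _∧_; T)
open import Data.Bool.Properties using (T-∧)
open import Data.List using (List; []; _∷_; length)
open import Data.Nat using (ℕ; zero; suc; _+_; _⊔_; _<ᵇ_; _≤_; s≤s)
open import Data.Nat.Properties
  using (+-suc; +-identityʳ; m≤m⊔n; m≤n⊔m; n≤1+n; n<1+n; <-≤-trans; <ᵇ⇒<; <⇒<ᵇ)
open import Data.Product using (∃; _×_; _,_; proj₁; proj₂)
import Data.Product as Product
open import Data.Unit using (tt)
open import Data.Vec using (Vec; []; _∷_)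
open import Function using (_∘_; Equivalence)
open import Relation.Binary.PropositionalEquality

T-∧ˡ : ∀ {a b} → T (a ∧ b) → T a
T-∧ˡ = proj₁ ∘ Equivalence.to T-∧

T-∧ʳ : ∀ {a b} → T (a ∧ b) → T b
T-∧ʳ = proj₂ ∘ Equivalence.to T-∧

T-∧-intro : ∀ {a b} → T a → T b → T (a ∧ b)
T-∧-intro p q = Equivalence.from T-∧ (p , q)

T-∧-map : ∀ {a b a′ b′} → (T a → T a′) → (T b → T b′) → T (a ∧ b) → T (a′ ∧ b′)
T-∧-map f g = Equivalence.from T-∧ ∘ Product.map f g ∘ Equivalence.to T-∧

infixr 5 _∷ₛ_

_∷ₛ_ : Term → (ℕ → Term) → ℕ → Term
(t ∷ₛ σ) zero = t
(t ∷ₛ σ) (suc m) = σ m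

AgreeBelow : ℕ → (ℕ → Term) → (ℕ → Term) → Set
AgreeBelow k σ τ = ∀ m → T (m <ᵇ k) → σ m ≡ τ m

mutual
  subT-cong : ∀ {σ τ} → σ ≗ τ → ∀ u → subT σ u ≡ subT τ u
  subT-cong e (var n) = e n
  subT-cong e (fn k i ts) = cong (fn k i) (subTs-cong e ts)

  subTs-cong : ∀ {σ τ k} → σ ≗ τ → (ts : Vec Term k) → subTs σ ts ≡ subTs τ ts
  subTs-cong e [] = refl
  subTs-cong e (t ∷ ts) = cong₂ _∷_ (subT-cong e t) (subTs-cong e ts)

mutual
  subT-agree : ∀ {k σ τ} → AgreeBelow k σ τ → ∀ u → T (closedT k u) → subT σ u ≡ subT τ u
  subT-agree a (var n) c = a n c
  subT-agree a (fn k i ts) c = cong (fn k i) (subTs-agree a ts c)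

  subTs-agree : ∀ {k σ τ j} → AgreeBelow k σ τ → (ts : Vec Term j) → T (closedTs k ts) →
                subTs σ ts ≡ subTs τ ts
  subTs-agree a [] c = refl
  subTs-agree a (t ∷ ts) c = cong₂ _∷_ (subT-agree a t (T-∧ˡ c)) (subTs-agree a ts (T-∧ʳ c))

mutual
  subT-renT : ∀ σ ρ u → subT σ (renT ρ u) ≡ subT (σ ∘ ρ) u
  subT-renT σ ρ (var n) = refl
  subT-renT σ ρ (fn k i ts) = cong (fn k i) (subTs-renTs σ ρ ts)

  subTs-renTs : ∀ {k} σ ρ (ts : Vec Term k) → subTs σ (renTs ρ ts) ≡ subTs (σ ∘ ρ) ts
  subTs-renTs σ ρ [] = refl
  subTs-renTs σ ρ (t ∷ ts) = cong₂ _∷_ (subT-renT σ ρ t) (subTs-renTs σ ρ ts)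

mutual
  renT-subT : ∀ ρ τ u → renT ρ (subT τ u) ≡ subT (renT ρ ∘ τ) u
  renT-subT ρ τ (var n) = refl
  renT-subT ρ τ (fn k i ts) = cong (fn k i) (renTs-subTs ρ τ ts)

  renTs-subTs : ∀ {k} ρ τ (ts : Vec Term k) → renTs ρ (subTs τ ts) ≡ subTs (renT ρ ∘ τ) ts
  renTs-subTs ρ τ [] = refl
  renTs-subTs ρ τ (t ∷ ts) = cong₂ _∷_ (renT-subT ρ τ t) (renTs-subTs ρ τ ts)

mutual
  subT-subT : ∀ τ σ u → subT τ (subT σ u) ≡ subT (subT τ ∘ σ) u
  subT-subT τ σ (var n) = refl
  subT-subT τ σ (fn k i ts) = cong (fn k i) (subTs-subTs τ σ ts)

  subTs-subTs : ∀ {k} τ σ (ts : Vec Term k) → subTs τ (subTs σ ts) ≡ subTs (subT τ ∘ σ) ts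
  subTs-subTs τ σ [] = refl
  subTs-subTs τ σ (t ∷ ts) = cong₂ _∷_ (subT-subT τ σ t) (subTs-subTs τ σ ts)

mutual
  subT-id : ∀ u → subT var u ≡ u
  subT-id (var n) = refl
  subT-id (fn k i ts) = cong (fn k i) (subTs-id ts)

  subTs-id : ∀ {k} (ts : Vec Term k) → subTs var ts ≡ ts
  subTs-id [] = refl
  subTs-id (t ∷ ts) = cong₂ _∷_ (subT-id t) (subTs-id ts)

exts-cong : ∀ {σ τ} → σ ≗ τ → exts σ ≗ exts τ
exts-cong e zero = refl
exts-cong e (suc m) = cong (renT suc) (e m)

exts-agree : ∀ {k σ τ} → AgreeBelow k σ τ → AgreeBelow (suc k) (exts σ) (exts τ)
exts-agree a zero c = refl
exts-agree a (suc m) c = cong (renT suc) (a m c)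

exts-ext : ∀ σ ρ → exts σ ∘ ext ρ ≗ exts (σ ∘ ρ)
exts-ext σ ρ zero = refl
exts-ext σ ρ (suc m) = refl

exts-subT : ∀ τ σ → subT (exts τ) ∘ exts σ ≗ exts (subT τ ∘ σ)
exts-subT τ σ zero = refl
exts-subT τ σ (suc m) = trans (subT-renT (exts τ) suc (σ m)) (sym (renT-subT suc τ (σ m)))

exts-id : exts var ≗ var
exts-id zero = refl
exts-id (suc m) = refl

subF-cong : ∀ {σ τ} → σ ≗ τ → ∀ A → subF σ A ≡ subF τ A
subF-cong e (rel k i ts) = cong (rel k i) (subTs-cong e ts)
subF-cong e ⊥' = refl
subF-cong e (A ∧' B) = cong₂ _∧'_ (subF-cong e A) (subF-cong e B)
subF-cong e (A ∨' B) = cong₂ _∨'_ (subF-cong e A) (subF-cong e B)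
subF-cong e (A ⇒ B) = cong₂ _⇒_ (subF-cong e A) (subF-cong e B)
subF-cong e (∀' A) = cong ∀' (subF-cong (exts-cong e) A)
subF-cong e (∃' A) = cong ∃' (subF-cong (exts-cong e) A)

subF-agree : ∀ {k σ τ} → AgreeBelow k σ τ → ∀ A → T (closedF k A) → subF σ A ≡ subF τ A
subF-agree a (rel k i ts) c = cong (rel k i) (subTs-agree a ts c)
subF-agree a ⊥' c = refl
subF-agree a (A ∧' B) c = cong₂ _∧'_ (subF-agree a A (T-∧ˡ c)) (subF-agree a B (T-∧ʳ c))
subF-agree a (A ∨' B) c = cong₂ _∨'_ (subF-agree a A (T-∧ˡ c)) (subF-agree a B (T-∧ʳ c))
subF-agree a (A ⇒ B) c = cong₂ _⇒_ (subF-agree a A (T-∧ˡ c)) (subF-agree a B (T-∧ʳ c))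
subF-agree a (∀' A) c = cong ∀' (subF-agree (exts-agree a) A c)
subF-agree a (∃' A) c = cong ∃' (subF-agree (exts-agree a) A c)

subF-renF : ∀ σ ρ A → subF σ (renF ρ A) ≡ subF (σ ∘ ρ) A
subF-renF σ ρ (rel k i ts) = cong (rel k i) (subTs-renTs σ ρ ts)
subF-renF σ ρ ⊥' = refl
subF-renF σ ρ (A ∧' B) = cong₂ _∧'_ (subF-renF σ ρ A) (subF-renF σ ρ B)
subF-renF σ ρ (A ∨' B) = cong₂ _∨'_ (subF-renF σ ρ A) (subF-renF σ ρ B)
subF-renF σ ρ (A ⇒ B) = cong₂ _⇒_ (subF-renF σ ρ A) (subF-renF σ ρ B)
subF-renF σ ρ (∀' A) = cong ∀' (trans (subF-renF (exts σ) (ext ρ) A) (subF-cong (exts-ext σ ρ) A))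
subF-renF σ ρ (∃' A) = cong ∃' (trans (subF-renF (exts σ) (ext ρ) A) (subF-cong (exts-ext σ ρ) A))

subF-subF : ∀ τ σ A → subF τ (subF σ A) ≡ subF (subT τ ∘ σ) A
subF-subF τ σ (rel k i ts) = cong (rel k i) (subTs-subTs τ σ ts)
subF-subF τ σ ⊥' = refl
subF-subF τ σ (A ∧' B) = cong₂ _∧'_ (subF-subF τ σ A) (subF-subF τ σ B)
subF-subF τ σ (A ∨' B) = cong₂ _∨'_ (subF-subF τ σ A) (subF-subF τ σ B)
subF-subF τ σ (A ⇒ B) = cong₂ _⇒_ (subF-subF τ σ A) (subF-subF τ σ B)
subF-subF τ σ (∀' A) = cong ∀' (trans (subF-subF (exts τ) (exts σ) A) (subF-cong (exts-subT τ σ) A))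
subF-subF τ σ (∃' A) = cong ∃' (trans (subF-subF (exts τ) (exts σ) A) (subF-cong (exts-subT τ σ) A))

subF-id : ∀ A → subF var A ≡ A
subF-id (rel k i ts) = cong (rel k i) (subTs-id ts)
subF-id ⊥' = refl
subF-id (A ∧' B) = cong₂ _∧'_ (subF-id A) (subF-id B)
subF-id (A ∨' B) = cong₂ _∨'_ (subF-id A) (subF-id B)
subF-id (A ⇒ B) = cong₂ _⇒_ (subF-id A) (subF-id B)
subF-id (∀' A) = cong ∀' (trans (subF-cong exts-id A) (subF-id A))
subF-id (∃' A) = cong ∃' (trans (subF-cong exts-id A) (subF-id A))

subF-closed : ∀ σ A → Closed A → subF σ A ≡ A
subF-closed σ A cl = trans (subF-agree (λ m ()) A cl) (subF-id A)

inst-renF-ext-suc : ∀ A → renF (ext suc) A [ var zero /0] ≡ A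
inst-renF-ext-suc A = trans (subF-renF (inst (var zero)) (ext suc) A) (trans (subF-cong e A) (subF-id A))
  where
  e : inst (var zero) ∘ ext suc ≗ var
  e zero = refl
  e (suc m) = refl

inst-exts : ∀ σ t A → subF (exts σ) A [ t /0] ≡ subF (t ∷ₛ σ) A
inst-exts σ t A = trans (subF-subF (inst t) (exts σ) A) (subF-cong e A)
  where
  e : subT (inst t) ∘ exts σ ≗ t ∷ₛ σ
  e zero = refl
  e (suc m) = trans (subT-renT (inst t) suc (σ m)) (subT-id (σ m))

inst-exts-shift : ∀ σ t B → subF (exts σ) (shift B) [ t /0] ≡ subF σ B
inst-exts-shift σ t B = trans (inst-exts σ t (shift B)) (subF-renF (t ∷ₛ σ) suc B)

inst-exts-lookupEnv : ∀ env t A → subF (exts (lookupEnv env)) A [ t /0] ≡ subF (lookupEnv (t ∷ env)) A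
inst-exts-lookupEnv env t A = trans (inst-exts (lookupEnv env) t A) (subF-cong e A)
  where
  e : t ∷ₛ lookupEnv env ≗ lookupEnv (t ∷ env)
  e zero = refl
  e (suc m) = refl

length-shiftEnv : ∀ env → length (shiftEnv env) ≡ length env
length-shiftEnv [] = refl
length-shiftEnv (t ∷ env) = cong suc (length-shiftEnv env)

lookupEnv-shiftEnv : ∀ env m → T (m <ᵇ length env) →
                     lookupEnv (shiftEnv env) m ≡ renT suc (lookupEnv env m)
lookupEnv-shiftEnv (t ∷ env) zero c = refl
lookupEnv-shiftEnv (t ∷ env) (suc m) c = lookupEnv-shiftEnv env m c

-- Beyond its length an environment acts as a shifted identity, so
-- extending it under a binder agrees with exts only on in-scope variables.
exts-lookupEnv : ∀ env A → T (closedF (suc (length env)) A) →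
                 subF (exts (lookupEnv env)) A ≡ subF (lookupEnv (var zero ∷ shiftEnv env)) A
exts-lookupEnv env = subF-agree agree
  where
  agree : AgreeBelow (suc (length env)) (exts (lookupEnv env)) (lookupEnv (var zero ∷ shiftEnv env))
  agree zero c = refl
  agree (suc m) c = sym (lookupEnv-shiftEnv env m c)

closedF-shiftEnv : ∀ env A → T (closedF (suc (length env)) A) →
                   T (closedF (length (var zero ∷ shiftEnv env)) A)
closedF-shiftEnv env A = subst (λ k → T (closedF (suc k) A)) (sym (length-shiftEnv env))

<ᵇ-mono : ∀ {k k′} m → k ≤ k′ → T (m <ᵇ k) → T (m <ᵇ k′)
<ᵇ-mono {k} m le c = <⇒<ᵇ (<-≤-trans (<ᵇ⇒< m k c) le)

mutual
  closedT-mono : ∀ {k k′} → k ≤ k′ → ∀ u → T (closedT k u) → T (closedT k′ u)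
  closedT-mono le (var n) = <ᵇ-mono n le
  closedT-mono le (fn k i ts) = closedTs-mono le ts

  closedTs-mono : ∀ {k k′ j} → k ≤ k′ → (ts : Vec Term j) → T (closedTs k ts) → T (closedTs k′ ts)
  closedTs-mono le [] c = tt
  closedTs-mono le (t ∷ ts) = T-∧-map (closedT-mono le t) (closedTs-mono le ts)

closedF-mono : ∀ {k k′} → k ≤ k′ → ∀ A → T (closedF k A) → T (closedF k′ A)
closedF-mono le (rel k i ts) = closedTs-mono le ts
closedF-mono le ⊥' c = tt
closedF-mono le (A ∧' B) = T-∧-map (closedF-mono le A) (closedF-mono le B)
closedF-mono le (A ∨' B) = T-∧-map (closedF-mono le A) (closedF-mono le B)
closedF-mono le (A ⇒ B) = T-∧-map (closedF-mono le A) (closedF-mono le B)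
closedF-mono le (∀' A) = closedF-mono (s≤s le) A
closedF-mono le (∃' A) = closedF-mono (s≤s le) A

mutual
  closedT-bound : ∀ u → ∃ λ n → T (closedT n u)
  closedT-bound (var n) = suc n , <⇒<ᵇ (n<1+n n)
  closedT-bound (fn k i ts) = closedTs-bound ts

  closedTs-bound : ∀ {j} (ts : Vec Term j) → ∃ λ n → T (closedTs n ts)
  closedTs-bound [] = zero , tt
  closedTs-bound (t ∷ ts) with closedT-bound t | closedTs-bound ts
  ... | n₁ , c₁ | n₂ , c₂ =
    n₁ ⊔ n₂ , T-∧-intro (closedT-mono (m≤m⊔n n₁ n₂) t c₁) (closedTs-mono (m≤n⊔m n₁ n₂) ts c₂)

mutual
  closedF-bound : ∀ A → ∃ λ n → T (closedF n A)
  closedF-bound (rel k i ts) = closedTs-bound ts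
  closedF-bound ⊥' = zero , tt
  closedF-bound (A ∧' B) = closedF-bound₂ A B
  closedF-bound (A ∨' B) = closedF-bound₂ A B
  closedF-bound (A ⇒ B) = closedF-bound₂ A B
  closedF-bound (∀' A) = let n , c = closedF-bound A in n , closedF-mono (n≤1+n n) A c
  closedF-bound (∃' A) = let n , c = closedF-bound A in n , closedF-mono (n≤1+n n) A c

  closedF-bound₂ : ∀ A B → ∃ λ n → T (closedF n A ∧ closedF n B)
  closedF-bound₂ A B with closedF-bound A | closedF-bound B
  ... | n₁ , c₁ | n₂ , c₂ =
    n₁ ⊔ n₂ , T-∧-intro (closedF-mono (m≤m⊔n n₁ n₂) A c₁) (closedF-mono (m≤n⊔m n₁ n₂) B c₂)

infix 2 ⊢_

⊢_ : Formula → Set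
⊢_ = IQC

⊢-K : ∀ {A B} → ⊢ B → ⊢ A ⇒ B
⊢-K = mp (iqc (k-ax _ _))

⊢-S : ∀ {A B C} → ⊢ A ⇒ B ⇒ C → ⊢ A ⇒ B → ⊢ A ⇒ C
⊢-S f g = mp (mp (iqc (s-ax _ _ _)) f) g

⊢-castˡ : ∀ {A A′ B} → A ≡ A′ → ⊢ A ⇒ B → ⊢ A′ ⇒ B
⊢-castˡ refl d = d

⊢-castʳ : ∀ {A B B′} → B ≡ B′ → ⊢ A ⇒ B → ⊢ A ⇒ B′
⊢-castʳ refl d = d

⇒-refl : ∀ {A} → ⊢ A ⇒ A
⇒-refl {A} = ⊢-S (iqc (k-ax A (A ⇒ A))) (iqc (k-ax A A))

⇒-postcomp : ∀ {A B C} → ⊢ B ⇒ C → ⊢ (A ⇒ B) ⇒ (A ⇒ C)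
⇒-postcomp g = mp (iqc (s-ax _ _ _)) (⊢-K g)

⇒-trans : ∀ {A B C} → ⊢ A ⇒ B → ⊢ B ⇒ C → ⊢ A ⇒ C
⇒-trans f g = mp (⇒-postcomp g) f

⇒-precomp : ∀ {A A′ B} → ⊢ A′ ⇒ A → ⊢ (A ⇒ B) ⇒ (A′ ⇒ B)
⇒-precomp f = ⊢-S (⇒-trans (iqc (k-ax _ _)) (iqc (s-ax _ _ _))) (⊢-K f)

⇒-mono : ∀ {A A′ B B′} → ⊢ A′ ⇒ A → ⊢ B ⇒ B′ → ⊢ (A ⇒ B) ⇒ (A′ ⇒ B′)
⇒-mono f g = ⇒-trans (⇒-precomp f) (⇒-postcomp g)

∧-mono : ∀ {A A′ B B′} → ⊢ A ⇒ A′ → ⊢ B ⇒ B′ → ⊢ A ∧' B ⇒ A′ ∧' B′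
∧-mono f g = ⊢-S (⇒-trans (⇒-trans (iqc (∧e₁ _ _)) f) (iqc (∧i _ _))) (⇒-trans (iqc (∧e₂ _ _)) g)

∨-mono : ∀ {A A′ B B′} → ⊢ A ⇒ A′ → ⊢ B ⇒ B′ → ⊢ A ∨' B ⇒ A′ ∨' B′
∨-mono f g = mp (mp (iqc (∨e _ _ _)) (⇒-trans f (iqc (∨i₁ _ _)))) (⇒-trans g (iqc (∨i₂ _ _)))

∀-mono : ∀ {A B} → ⊢ A ⇒ B → ⊢ ∀' A ⇒ ∀' B
∀-mono {A} {B} f = mp (iqc (∀i B (∀' A))) (gen (⇒-trans elim f))
  where
  elim : ⊢ shift (∀' A) ⇒ A
  elim = ⊢-castʳ (inst-renF-ext-suc A) (iqc (∀e (renF (ext suc) A) (var zero)))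

∃-mono : ∀ {A B} → ⊢ A ⇒ B → ⊢ ∃' A ⇒ ∃' B
∃-mono {A} {B} f = mp (iqc (∃e A (∃' B))) (gen (⇒-trans f intro))
  where
  intro : ⊢ B ⇒ shift (∃' B)
  intro = ⊢-castˡ (inst-renF-ext-suc B) (iqc (∃i (renF (ext suc) B) (var zero)))

∀ⁿ : ℕ → Formula → Formula
∀ⁿ zero A = A
∀ⁿ (suc n) A = ∀' (∀ⁿ n A)

∀ⁿ-elim : ∀ n A σ τ → τ ∘ (n +_) ≗ σ → ⊢ subF σ (∀ⁿ n A) ⇒ subF τ A
∀ⁿ-elim zero A σ τ e = ⊢-castʳ (subF-cong (sym ∘ e) A) ⇒-refl
∀ⁿ-elim (suc n) A σ τ e =
  ⇒-trans (⊢-castʳ (inst-exts σ (τ n) (∀ⁿ n A)) (iqc (∀e (subF (exts σ) (∀ⁿ n A)) (τ n))))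
          (∀ⁿ-elim n A (τ n ∷ₛ σ) τ e′)
  where
  e′ : τ ∘ (n +_) ≗ τ n ∷ₛ σ
  e′ zero = cong τ (+-identityʳ n)
  e′ (suc m) = trans (cong τ (+-suc n m)) (e m)

closedF-∀ⁿ : ∀ n d A → T (closedF (n + d) A) → T (closedF d (∀ⁿ n A))
closedF-∀ⁿ zero d A c = c
closedF-∀ⁿ (suc n) d A c = closedF-∀ⁿ n (suc d) A (subst (λ k → T (closedF k A)) (sym (+-suc n d)) c)

closureDepth : Formula → ℕ
closureDepth A = proj₁ (closedF-bound A)

closedF-closureDepth : ∀ A → T (closedF (closureDepth A) A)
closedF-closureDepth A = proj₂ (closedF-bound A)

closure : Formula → Formula
closure A = ∀ⁿ (closureDepth A) A

closure-closed : ∀ A → Closed (closure A)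
closure-closed A =
  closedF-∀ⁿ n zero A (subst (λ k → T (closedF k A)) (sym (+-identityʳ n)) (closedF-closureDepth A))
  where
  n = closureDepth A

closure⇒ : ∀ A → ⊢ closure A ⇒ A
closure⇒ A =
  ⊢-castˡ (subF-closed (var ∘ (n +_)) (closure A) (closure-closed A))
          (⊢-castʳ (subF-id A) (∀ⁿ-elim n A (var ∘ (n +_)) var (λ m → refl)))
  where
  n = closureDepth A

-- Only derivability matters here.
module Skolemization (base : ℕ) where

  skF : Bool → ℕ → List Term → ℕ → Formula → Formula
  skF p d env c A = proj₁ (sk base p d env c A)

  skC : Bool → ℕ → List Term → ℕ → Formula → ℕ
  skC p d env c A = proj₂ (sk base p d env c A)

  skolemTerm : ℕ → ℕ → Term
  skolemTerm d c = fn d (base + c) (skArgs d)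

  mutual
    sk⁻⇒instance : ∀ d env c A → T (closedF (length env) A) →
                   ⊢ skF false d env c A ⇒ subF (lookupEnv env) A
    sk⁻⇒instance d env c (rel k i ts) cl = ⇒-refl
    sk⁻⇒instance d env c ⊥' cl = ⇒-refl
    sk⁻⇒instance d env c (A ∧' B) cl =
      ∧-mono (sk⁻⇒instance d env c A (T-∧ˡ cl)) (sk⁻⇒instance d env _ B (T-∧ʳ cl))
    sk⁻⇒instance d env c (A ∨' B) cl =
      ∨-mono (sk⁻⇒instance d env c A (T-∧ˡ cl)) (sk⁻⇒instance d env _ B (T-∧ʳ cl))
    sk⁻⇒instance d env c (A ⇒ B) cl =
      ⇒-mono (instance⇒sk⁺ d env c A (T-∧ˡ cl)) (sk⁻⇒instance d env _ B (T-∧ʳ cl))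
    sk⁻⇒instance d env c (∀' A) cl =
      ∀-mono (⊢-castʳ (sym (exts-lookupEnv env A cl))
        (sk⁻⇒instance (suc d) (var zero ∷ shiftEnv env) c A (closedF-shiftEnv env A cl)))
    sk⁻⇒instance d env c (∃' A) cl =
      ⇒-trans (sk⁻⇒instance d (t ∷ env) (suc c) A cl)
              (⊢-castˡ (inst-exts-lookupEnv env t A) (iqc (∃i (subF (exts (lookupEnv env)) A) t)))
      where
      t = skolemTerm d c

    instance⇒sk⁺ : ∀ d env c A → T (closedF (length env) A) →
                   ⊢ subF (lookupEnv env) A ⇒ skF true d env c A
    instance⇒sk⁺ d env c (rel k i ts) cl = ⇒-refl
    instance⇒sk⁺ d env c ⊥' cl = ⇒-refl
    instance⇒sk⁺ d env c (A ∧' B) cl =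
      ∧-mono (instance⇒sk⁺ d env c A (T-∧ˡ cl)) (instance⇒sk⁺ d env _ B (T-∧ʳ cl))
    instance⇒sk⁺ d env c (A ∨' B) cl =
      ∨-mono (instance⇒sk⁺ d env c A (T-∧ˡ cl)) (instance⇒sk⁺ d env _ B (T-∧ʳ cl))
    instance⇒sk⁺ d env c (A ⇒ B) cl =
      ⇒-mono (sk⁻⇒instance d env c A (T-∧ˡ cl)) (instance⇒sk⁺ d env _ B (T-∧ʳ cl))
    instance⇒sk⁺ d env c (∃' A) cl =
      ∃-mono (⊢-castˡ (sym (exts-lookupEnv env A cl))
        (instance⇒sk⁺ (suc d) (var zero ∷ shiftEnv env) c A (closedF-shiftEnv env A cl)))
    instance⇒sk⁺ d env c (∀' A) cl =
      ⇒-trans (⊢-castʳ (inst-exts-lookupEnv env t A) (iqc (∀e (subF (exts (lookupEnv env)) A) t)))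
              (instance⇒sk⁺ d (t ∷ env) (suc c) A cl)
      where
      t = skolemTerm d c

  ⊢sk⁺-QFSAxiom : ∀ {φ} → QFSAxiom φ → ∀ d env c → T (closedF (length env) φ) → ⊢ skF true d env c φ
  ⊢sk⁺-QFSAxiom (CD A B) d env c cl =
    ⇒-trans (sk⁻⇒instance d env c (∀' (A ∨' shift B)) (T-∧ˡ cl))
      (⇒-trans (⊢-castʳ (cong₂ _∨'_ (inst-exts-lookupEnv env t A) (inst-exts-shift σ t B))
                        (iqc (∀e (subF (exts σ) (A ∨' shift B)) t)))
               (∨-mono (instance⇒sk⁺ d (t ∷ env) _ A (T-∧ˡ clConclusion))
                       (instance⇒sk⁺ d env _ B (T-∧ʳ clConclusion))))
    where
    σ = lookupEnv env
    t = skolemTerm d (skC false d env c (∀' (A ∨' shift B)))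
    clConclusion : T (closedF (length env) (∀' A ∨' B))
    clConclusion = T-∧ʳ {closedF (length env) (∀' (A ∨' shift B))} cl
  ⊢sk⁺-QFSAxiom (ED A B) d env c cl =
    ⇒-trans (⇒-mono (instance⇒sk⁺ d env c B (T-∧ˡ clPremise))
                    (sk⁻⇒instance d (t ∷ env) _ A (T-∧ʳ clPremise)))
      (⇒-trans (⊢-castˡ (cong₂ _⇒_ (inst-exts-shift σ t B) (inst-exts-lookupEnv env t A))
                        (iqc (∃i (subF (exts σ) (shift B ⇒ A)) t)))
               (∃-mono (⊢-castˡ (sym (exts-lookupEnv env (shift B ⇒ A) clMatrix))
                 (instance⇒sk⁺ (suc d) (var zero ∷ shiftEnv env) _ (shift B ⇒ A)
                   (closedF-shiftEnv env (shift B ⇒ A) clMatrix)))))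
    where
    σ = lookupEnv env
    t = skolemTerm d (skC true d env c B)
    clPremise : T (closedF (length env) (B ⇒ ∃' A))
    clPremise = T-∧ˡ cl
    clMatrix : T (closedF (suc (length env)) (shift B ⇒ A))
    clMatrix = T-∧ʳ {closedF (length env) (B ⇒ ∃' A)} cl
  ⊢sk⁺-QFSAxiom (SW A B) d env c cl =
    ⇒-trans (⇒-mono (instance⇒sk⁺ d (t ∷ env) (suc c) A (T-∧ˡ clPremise))
                    (sk⁻⇒instance d env _ B (T-∧ʳ clPremise)))
      (⇒-trans (⊢-castˡ (cong₂ _⇒_ (inst-exts-lookupEnv env t A) (inst-exts-shift σ t B))
                        (iqc (∃i (subF (exts σ) (A ⇒ shift B)) t)))
               (∃-mono (⊢-castˡ (sym (exts-lookupEnv env (A ⇒ shift B) clMatrix))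
                 (instance⇒sk⁺ (suc d) (var zero ∷ shiftEnv env) _ (A ⇒ shift B)
                   (closedF-shiftEnv env (A ⇒ shift B) clMatrix)))))
    where
    σ = lookupEnv env
    t = skolemTerm d c
    clPremise : T (closedF (length env) (∀' A ⇒ B))
    clPremise = T-∧ˡ cl
    clMatrix : T (closedF (suc (length env)) (A ⇒ shift B))
    clMatrix = T-∧ʳ {closedF (length env) (∀' A ⇒ B)} cl

  sk⁺-∀ⁿ : ∀ n d env c A → ∃ λ env′ → ∃ λ c′ →
           length env′ ≡ n + length env × skF true d env c (∀ⁿ n A) ≡ skF true d env′ c′ A
  sk⁺-∀ⁿ zero d env c A = env , c , refl , refl
  sk⁺-∀ⁿ (suc n) d env c A =
    let env′ , c′ , len , eq = sk⁺-∀ⁿ n d (skolemTerm d c ∷ env) (suc c) A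
    in env′ , c′ , trans len (+-suc n (length env)) , eq

⊢skolem-closure : ∀ {A} → QFSAxiom A → ⊢ skolem (closure A)
⊢skolem-closure {A} q =
  let env , c , len , eq = sk⁺-∀ⁿ n zero [] zero A
      clA = subst (λ k → T (closedF k A)) (sym (trans len (+-identityʳ n))) (closedF-closureDepth A)
  in subst ⊢_ (sym eq) (⊢sk⁺-QFSAxiom q zero env c clA)
  where
  n = closureDepth A
  open Skolemization (suc (maxFnF (closure A)))

module _ {Ax L : Formula → Set} (isLogic : IsLogic L) (axioms⊆ : ∀ {A} → Ax A → L A) where
  open IsLogic isLogic

  derivable⊆logic : ∀ {A} → Derivable Ax A → L A
  derivable⊆logic (iqc a) = axioms a
  derivable⊆logic (ax a) = axioms⊆ a
  derivable⊆logic (mp d e) = closed-mp (derivable⊆logic d) (derivable⊆logic e)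
  derivable⊆logic (gen d) = closed-gen (derivable⊆logic d)

mainTheorem3 : (L : Formula → Set) → IsIntermediate L
             → (∀ φ → Closed φ → (L φ → L (skolem φ)) × (L (skolem φ) → L φ))
             → ∀ φ → QFS φ → L φ
mainTheorem3 L isIntermediate skolemization _ = derivable⊆logic isLogic QFSAxiom⊆L
  where
  open IsIntermediate isIntermediate
  open IsLogic isLogic using (closed-mp)

  QFSAxiom⊆L : ∀ {A} → QFSAxiom A → L A
  QFSAxiom⊆L {A} q =
    closed-mp (iqc⊆ _ (closure⇒ A))
              (proj₂ (skolemization (closure A) (closure-closed A)) (iqc⊆ _ (⊢skolem-closure q)))
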